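{- Let $m\ge 4$ and $n\ge \frac{m(m-1)}{2}$ be integers. Then \[RS_m(n)=\left\lceil \frac{(m-3)n+\frac{m(m-1)}{2}}{m-2}\right\rceil.\]
   Context: For $m\ge 3$, $E_m$ denotes the equation $x_1+x_2+\cdots+x_{m-1}=x_m$. For a positive integer $n$, $[1,n]=\{1,2,\ldots,n\}$. An $r$-coloring of a set $S$ is a map $S\to\{1,\ldots,r\}$; it is exact if it is surjective. A solution to $E_m$ in $[1,n]$ is a tuple $(x_1,\ldots,x_m)$ of elements of $[1,n]$ satisfying $E_m$; under a coloring it is rainbow if the $m$ elements $x_1,\ldots,x_m$ receive pairwise distinct colors. For $m\ge 3$ and $n\ge \frac{m(m-1)}{2}$, the rainbow Schur number $RS_m(n)$ is the minimum positive integer $r$ such that every exact $r$-coloring of $[1,n]$ admits a rainbow solution to $E_m$ in $[1,n]$. -}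

module Defs where

open import Data.Nat using (ℕ; zero; suc; _+_; _*_; _∸_; _/_; _≤_)
open import Data.Fin using (Fin; toℕ; inject₁; fromℕ)
open import Data.List using (tabulate)
open import Data.Nat.ListAction using (sum)
open import Data.Product using (_×_; Σ)
open import Data.Empty using (⊥)
open import Relation.Binary.PropositionalEquality using (_≡_)
open import Function.Definitions using (Injective; Surjective)

-- The element i : Fin n represents the integer (toℕ i + 1) ∈ [1,n].
val : ∀ {n} → Fin n → ℕ
val i = suc (toℕ i)

Coloring : ℕ → ℕ → Set
Coloring n r = Fin n → Fin r

Exact : ∀ {n r} → Coloring n r → Set
Exact c = Surjective _≡_ _≡_ c

-- x : Fin m → Fin n is the tuple (x_1,…,x_m) of elements of [1,n];
-- it solves E_m : x_1 + ⋯ + x_{m-1} = x_m.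
IsSolution : ∀ {n} (m : ℕ) → (Fin m → Fin n) → Set
IsSolution zero    x = ⊥
IsSolution (suc k) x = sum (tabulate (λ i → val (x (inject₁ i)))) ≡ val (x (fromℕ k))

Rainbow : ∀ {n r m} → Coloring n r → (Fin m → Fin n) → Set
Rainbow c x = Injective _≡_ _≡_ (λ i → c (x i))

HasRainbowProperty : ℕ → ℕ → ℕ → Set
HasRainbowProperty m n r =
  (c : Coloring n r) → Exact c →
  Σ (Fin m → Fin n) (λ x → IsSolution m x × Rainbow c x)

IsRS : ℕ → ℕ → ℕ → Set
IsRS m n s =
  (1 ≤ s × HasRainbowProperty m n s) ×
  (∀ r → 1 ≤ r → HasRainbowProperty m n r → s ≤ r)

-- Ceiling division ⌈ a / b ⌉ (b > 0); set to 0 for b = 0 (unused).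
ceilDiv : ℕ → ℕ → ℕ
ceilDiv a zero    = 0
ceilDiv a (suc d) = (a + d) / suc d

-- In an exact s-colouring of [1, n] the first occurrences of the s colours form a
-- set A ∋ 1 of numbers with pairwise distinct colours, and the bound (m - 3) n + m(m - 1)/2 ≤ (m - 2) s
-- says that A has at most (n - m(m - 1)/2)/(m - 2) gaps.  Let P be the sum of the m - 2 smallest
-- elements of A.  Past them lies a window of length greater than twice the number of gaps, so
-- some v in it has v, v + P ∈ A; these m elements of A form a rainbow solution of E_m.
--
-- For r < s colours, give one colour to [1, n - s + 2] and then a new colour to each
-- further number, until the colours run out.  The m - 1 summands of a rainbow solution lie on
-- distinct steps of this staircase, which forces their sum above n.
--
-- Throughout, m = 4 + j and t = m(m - 1)/2.

module Submission where

open import Defs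
open import Data.Nat
open import Data.Nat.Properties
open import Algebra.Properties.CommutativeSemigroup +-commutativeSemigroup using (interchange; x∙yz≈y∙xz)
open import Data.Bool using (Bool; true; false; not; _∧_; _∨_; T; if_then_else_)
open import Data.Bool.Properties using (T-∧; T-∨)
open import Data.Empty using (⊥-elim)
open import Data.Fin using (Fin; zero; suc; toℕ; fromℕ; fromℕ<; inject₁)
open import Data.Fin.Properties using (toℕ<n; toℕ-fromℕ<; toℕ-injective; inject₁-injective)
open import Data.List using (List; []; _∷_; _++_; _∷ʳ_; length; map; tabulate)
open import Data.List.Properties using (length-++; length-tabulate; map-tabulate; tabulate-cong; ++-assoc)
open import Data.List.Membership.Propositional using (_∈_)
open import Data.List.Membership.DecPropositional _≟_ using (_∈?_)
open import Data.List.Relation.Unary.All as All using (All; []; _∷_)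
import Data.List.Relation.Unary.All.Properties as All
open import Data.List.Relation.Unary.AllPairs using ([]; _∷_)
import Data.List.Relation.Unary.AllPairs.Properties as AllPairs
open import Data.List.Relation.Unary.Any using (here; there; _─_)
open import Data.List.Relation.Unary.Unique.Propositional using (Unique)
open import Data.List.Relation.Unary.Unique.Propositional.Properties using (tabulate⁺)
open import Data.Nat.Divisibility using (_∣_; divides; ∣m∣n⇒∣m+n; m∣m*n)
open import Data.Nat.DivMod using (m≡m%n+[m/n]*n; m%n<n; m/n*n≤m; m≥n⇒m/n>0; m*[n/m]≡n)
open import Data.Nat.ListAction using (sum)
open import Data.Nat.ListAction.Properties using (sum-++)
open import Data.Nat.Tactic.RingSolver using (solve-∀)
open import Data.Product using (Σ; _×_; _,_; proj₁; proj₂; map₁)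
open import Data.Sum using (_⊎_; inj₁; inj₂)
open import Data.Unit using (tt)
open import Function using (_∘_; Equivalence)
open import Relation.Binary.Core using (_Preserves_⟶_)
open import Relation.Binary.Definitions using (tri<; tri≈; tri>)
open import Relation.Binary.PropositionalEquality
open import Relation.Nullary using (¬_; yes; no)
open import Relation.Nullary.Decidable using (T?)

open Equivalence using (to; from)

-- Counting in intervals

bit : Bool → ℕ
bit b = if b then 1 else 0

bit≤1 : ∀ b → bit b ≤ 1
bit≤1 true  = ≤-refl
bit≤1 false = z≤n

bit-true : ∀ {b} → T b → bit b ≡ 1
bit-true {true} _ = refl

bit-false : ∀ {b} → ¬ T b → bit b ≡ 0
bit-false {true}  ¬b = ⊥-elim (¬b tt)
bit-false {false} _  = refl

bit-not : ∀ {b} → ¬ T b → bit (not b) ≡ 1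
bit-not {true}  ¬b = ⊥-elim (¬b tt)
bit-not {false} _  = refl

bit-not-true : ∀ {b} → T b → bit (not b) ≡ 0
bit-not-true {true} _ = refl

bit-mono : ∀ {b b′} → (T b → T b′) → bit b ≤ bit b′
bit-mono {false}         _ = z≤n
bit-mono {true} {true}   _ = ≤-refl
bit-mono {true} {false}  h = ⊥-elim (h tt)

bit-complement : ∀ b → bit b + bit (not b) ≡ 1
bit-complement true  = refl
bit-complement false = refl

bit-∨ : ∀ b b′ → bit (b ∨ b′) ≤ bit b + bit b′
bit-∨ true  _ = s≤s z≤n
bit-∨ false _ = ≤-refl

bit-window : ∀ b b′ → 1 ≤ bit (b ∧ b′) + bit (not b) + bit (not b′)
bit-window true  true  = s≤s z≤n
bit-window true  false = s≤s z≤n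
bit-window false _     = s≤s z≤n

count : (ℕ → Bool) → ℕ → ℕ → ℕ
count P a zero    = 0
count P a (suc k) = count P a k + bit (P (a + k))

InRange : ℕ → ℕ → ℕ → Set
InRange a k i = a ≤ i × i < a + k

inRange-weaken : ∀ {a k i} → InRange a k i → InRange a (suc k) i
inRange-weaken {a} {k} (a≤i , i<a+k) = a≤i , ≤-trans i<a+k (+-monoʳ-≤ a (n≤1+n k))

inRange-last : ∀ a k → InRange a (suc k) (a + k)
inRange-last a k = m≤m+n a k , +-monoʳ-< a (n<1+n k)

inRange-narrow : ∀ {a k i} → InRange a (suc k) i × a ≢ i → InRange (suc a) k i
inRange-narrow {a} {k} {i} ((a≤i , i<) , a≢i) = ≤∧≢⇒< a≤i a≢i , subst (i <_) (+-suc a k) i<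

count-mono : ∀ {P Q} a k → (∀ i → InRange a k i → T (P i) → T (Q i)) → count P a k ≤ count Q a k
count-mono a zero    _ = z≤n
count-mono a (suc k) h =
  +-mono-≤ (count-mono a k (λ i → h i ∘ inRange-weaken)) (bit-mono (h (a + k) (inRange-last a k)))

count-++ : ∀ P a k l → count P a (k + l) ≡ count P a k + count P (a + k) l
count-++ P a k zero    = trans (cong (count P a) (+-identityʳ k)) (sym (+-identityʳ _))
count-++ P a k (suc l) = begin
  count P a (k + suc l)                                  ≡⟨ cong (count P a) (+-suc k l) ⟩
  count P a (k + l) + bit (P (a + (k + l)))              ≡⟨ cong₂ _+_ (count-++ P a k l) (cong (bit ∘ P) (sym (+-assoc a k l))) ⟩
  count P a k + count P (a + k) l + bit (P (a + k + l))  ≡⟨ +-assoc (count P a k) _ _ ⟩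
  count P a k + count P (a + k) (suc l)                  ∎
  where open ≡-Reasoning

count-complement : ∀ P a k → count P a k + count (not ∘ P) a k ≡ k
count-complement P a zero    = refl
count-complement P a (suc k) = begin
  (count P a k + bit (P (a + k))) + (count (not ∘ P) a k + bit (not (P (a + k))))
    ≡⟨ interchange (count P a k) _ _ _ ⟩
  (count P a k + count (not ∘ P) a k) + (bit (P (a + k)) + bit (not (P (a + k))))
    ≡⟨ cong₂ _+_ (count-complement P a k) (bit-complement (P (a + k))) ⟩
  k + 1
    ≡⟨ +-comm k 1 ⟩
  suc k ∎
  where open ≡-Reasoning

count-∨ : ∀ P Q a k → count (λ i → P i ∨ Q i) a k ≤ count P a k + count Q a k
count-∨ P Q a zero    = z≤n
count-∨ P Q a (suc k) = begin
  count (λ i → P i ∨ Q i) a k + bit (P (a + k) ∨ Q (a + k))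
    ≤⟨ +-mono-≤ (count-∨ P Q a k) (bit-∨ (P (a + k)) (Q (a + k))) ⟩
  (count P a k + count Q a k) + (bit (P (a + k)) + bit (Q (a + k)))
    ≡⟨ interchange (count P a k) _ _ _ ⟩
  count P a (suc k) + count Q a (suc k) ∎
  where open ≤-Reasoning

count-all : ∀ P a k → (∀ i → InRange a k i → T (P i)) → count P a k ≡ k
count-all P a zero    _ = refl
count-all P a (suc k) h =
  trans (cong₂ _+_ (count-all P a k (λ i → h i ∘ inRange-weaken)) (bit-true (h (a + k) (inRange-last a k))))
        (+-comm k 1)

count-none : ∀ P a k → (∀ i → InRange a k i → ¬ T (P i)) → count P a k ≡ 0
count-none P a zero    _ = refl
count-none P a (suc k) h =
  cong₂ _+_ (count-none P a k (λ i → h i ∘ inRange-weaken)) (bit-false (h (a + k) (inRange-last a k)))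

count-≡ᵇ≤1 : ∀ x a k → count (x ≡ᵇ_) a k ≤ 1
count-≡ᵇ≤1 x a zero    = z≤n
count-≡ᵇ≤1 x a (suc k) with x ≟ a + k
... | yes refl = ≤-trans (≤-reflexive (cong (_+ bit (a + k ≡ᵇ a + k)) earlier-none)) (bit≤1 _)
  where
  earlier-none : count (x ≡ᵇ_) a k ≡ 0
  earlier-none = count-none _ a k (λ i (_ , i<x) x≡i → <⇒≢ i<x (sym (≡ᵇ⇒≡ (a + k) i x≡i)))
... | no  x≢ = begin
  count (x ≡ᵇ_) a k + bit (x ≡ᵇ (a + k))  ≡⟨ cong (count (x ≡ᵇ_) a k +_) (bit-false (x≢ ∘ ≡ᵇ⇒≡ x _)) ⟩
  count (x ≡ᵇ_) a k + 0                    ≡⟨ +-identityʳ _ ⟩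
  count (x ≡ᵇ_) a k                        ≤⟨ count-≡ᵇ≤1 x a k ⟩
  1                                        ∎
  where open ≤-Reasoning

count-suc : ∀ P a k → count P (suc a) k ≡ count (P ∘ suc) a k
count-suc P a zero    = refl
count-suc P a (suc k) = cong (_+ bit (P (suc (a + k)))) (count-suc P a k)

count-intermediate : ∀ P a k {t} → t ≤ count P a k → Σ ℕ λ l → l ≤ k × count P a l ≡ t
count-intermediate P a zero    z≤n = 0 , z≤n , refl
count-intermediate P a (suc k) {t} t≤count with t ≤? count P a k
... | yes t≤ = let l , l≤k , eq = count-intermediate P a k t≤ in l , m≤n⇒m≤1+n l≤k , eq
... | no  t≰ = suc k , ≤-refl , ≤-antisym count≤t t≤count
  where
  count≤t : count P a (suc k) ≤ t
  count≤t = ≤-trans (+-monoʳ-≤ _ (bit≤1 _)) (≤-trans (≤-reflexive (+-comm _ 1)) (≰⇒> t≰))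

count-witness : ∀ P a k → 0 < count P a k → Σ ℕ λ i → InRange a k i × T (P i)
count-witness P a (suc k) pos with P (a + k) in eq
... | true  = a + k , inRange-last a k , subst T (sym eq) tt
... | false = let i , i∈ , Pi = count-witness P a k (subst (0 <_) (+-identityʳ _) pos) in i , inRange-weaken i∈ , Pi

-- Each v in [a, a + k) has v and v + p in P, or misses P at v or at v + p.
count-window : ∀ P a p k →
  k ≤ count (λ v → P v ∧ P (v + p)) a k + count (not ∘ P) a k + count (not ∘ P) (a + p) k
count-window P a p zero    = z≤n
count-window P a p (suc k) = begin
  suc k
    ≡⟨ +-comm 1 k ⟩
  k + 1
    ≤⟨ +-mono-≤ (count-window P a p k) (bit-window (P (a + k)) (P (a + k + p))) ⟩
  (C₁ + C₂ + C₃) + (bit (P (a + k) ∧ P (a + k + p)) + bit (not (P (a + k))) + bit (not (P (a + k + p))))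
    ≡⟨ regroup C₁ C₂ C₃ _ _ _ ⟩
  (C₁ + bit (P (a + k) ∧ P (a + k + p))) + (C₂ + bit (not (P (a + k)))) + (C₃ + bit (not (P (a + k + p))))
    ≡⟨ cong (λ v → B + (C₃ + bit (not (P v)))) shift ⟩
  (C₁ + bit (P (a + k) ∧ P (a + k + p))) + (C₂ + bit (not (P (a + k)))) + (C₃ + bit (not (P (a + p + k)))) ∎
  where
  open ≤-Reasoning
  C₁ = count (λ v → P v ∧ P (v + p)) a k
  C₂ = count (not ∘ P) a k
  C₃ = count (not ∘ P) (a + p) k
  B = (C₁ + bit (P (a + k) ∧ P (a + k + p))) + (C₂ + bit (not (P (a + k))))
  regroup : ∀ X Y Z x y z → (X + Y + Z) + (x + y + z) ≡ (X + x) + (Y + y) + (Z + z)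
  regroup = solve-∀
  shift : a + k + p ≡ a + p + k
  shift = trans (+-assoc a k p) (trans (cong (a +_) (+-comm k p)) (sym (+-assoc a p k)))

elements : (ℕ → Bool) → ℕ → ℕ → List ℕ
elements P a zero    = []
elements P a (suc k) = if P (a + k) then a + k ∷ elements P a k else elements P a k

length-elements : ∀ P a k → length (elements P a k) ≡ count P a k
length-elements P a zero    = refl
length-elements P a (suc k) with P (a + k)
... | true  = trans (cong suc (length-elements P a k)) (+-comm 1 _)
... | false = trans (length-elements P a k) (sym (+-identityʳ _))

elements-all : ∀ P a k → All (λ i → InRange a k i × T (P i)) (elements P a k)
elements-all P a zero    = []
elements-all P a (suc k) with P (a + k) in eq
... | true  = (inRange-last a k , subst T (sym eq) tt) ∷ All.map (map₁ inRange-weaken) (elements-all P a k)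
... | false = All.map (map₁ inRange-weaken) (elements-all P a k)

elements-unique : ∀ P a k → Unique (elements P a k)
elements-unique P a zero    = []
elements-unique P a (suc k) with P (a + k)
... | true  = All.map (λ ((_ , i<a+k) , _) a+k≡i → <⇒≢ i<a+k (sym a+k≡i)) (elements-all P a k) ∷ elements-unique P a k
... | false = elements-unique P a k

-- c distinct numbers below a + k sum to at most (a + k - 1) + ⋯ + (a + k - c).
sum-elements : ∀ P a k → let c = count P a k in 2 * sum (elements P a k) + c * suc c ≤ 2 * c * (a + k)
sum-elements P a zero    = z≤n
sum-elements P a (suc k) with P (a + k)
... | true  = begin
  2 * (a + k + S) + (c + 1) * suc (c + 1)   ≡⟨ expand (a + k) S c ⟩
  (2 * S + c * suc c) + 2 * (a + k + c + 1) ≤⟨ +-monoˡ-≤ _ (sum-elements P a k) ⟩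
  2 * c * (a + k) + 2 * (a + k + c + 1)     ≡⟨ collect (a + k) c ⟩
  2 * (c + 1) * suc (a + k)                 ≡⟨ cong (2 * (c + 1) *_) (sym (+-suc a k)) ⟩
  2 * (c + 1) * (a + suc k)                 ∎
  where
  open ≤-Reasoning
  S = sum (elements P a k)
  c = count P a k
  expand : ∀ e S c → 2 * (e + S) + (c + 1) * suc (c + 1) ≡ (2 * S + c * suc c) + 2 * (e + c + 1)
  expand = solve-∀
  collect : ∀ e c → 2 * c * e + 2 * (e + c + 1) ≡ 2 * (c + 1) * suc e
  collect = solve-∀
... | false = begin
  2 * S + (c + 0) * suc (c + 0)  ≡⟨ cong (λ c → 2 * S + c * suc c) (+-identityʳ c) ⟩
  2 * S + c * suc c              ≤⟨ sum-elements P a k ⟩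
  2 * c * (a + k)                ≤⟨ *-monoʳ-≤ (2 * c) (+-monoʳ-≤ a (n≤1+n k)) ⟩
  2 * c * (a + suc k)            ≡⟨ cong (λ c → 2 * c * (a + suc k)) (sym (+-identityʳ c)) ⟩
  2 * (c + 0) * (a + suc k)      ∎
  where
  open ≤-Reasoning
  S = sum (elements P a k)
  c = count P a k

sumFrom : (ℕ → ℕ) → ℕ → ℕ → ℕ
sumFrom F a zero    = 0
sumFrom F a (suc L) = F a + sumFrom F (suc a) L

length-─ : ∀ {x : ℕ} xs (p : x ∈ xs) → length xs ≡ suc (length (xs ─ p))
length-─ (_ ∷ _)  (here _)  = refl
length-─ (_ ∷ xs) (there p) = cong suc (length-─ xs p)

sum-map-─ : ∀ (F : ℕ → ℕ) {x} xs (p : x ∈ xs) → sum (map F xs) ≡ F x + sum (map F (xs ─ p))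
sum-map-─ F (_ ∷ _)  (here refl) = refl
sum-map-─ F (y ∷ xs) (there p)   =
  trans (cong (F y +_) (sum-map-─ F xs p)) (x∙yz≈y∙xz (F y) (F _) _)

unique-─ : ∀ {x : ℕ} {xs} → Unique xs → (p : x ∈ xs) → Unique (xs ─ p)
unique-─ (_ ∷ u)  (here _)  = u
unique-─ (h ∷ u)  (there p) = All.─⁺ p h ∷ unique-─ u p

─-≢ : ∀ {x : ℕ} {xs} → Unique xs → (p : x ∈ xs) → All (x ≢_) (xs ─ p)
─-≢ (h ∷ _) (here refl) = h
─-≢ (h ∷ u) (there p)   = ≢-sym (All.lookup h p) ∷ ─-≢ u p

module _ {F : ℕ → ℕ} (F-mono : F Preserves _≤_ ⟶ _≤_) where

  sumFrom-mono : ∀ {a b} L → a ≤ b → sumFrom F a L ≤ sumFrom F b L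
  sumFrom-mono zero    _   = z≤n
  sumFrom-mono (suc L) a≤b = +-mono-≤ (F-mono a≤b) (sumFrom-mono L (s≤s a≤b))

  sumFrom-≤-sum : ∀ W a xs → Unique xs → All (InRange a W) xs → sumFrom F a (length xs) ≤ sum (map F xs)
  sumFrom-≤-sum zero    a []      _ _ = z≤n
  sumFrom-≤-sum zero    a (x ∷ _) _ ((a≤x , x<a+0) ∷ _) =
    ⊥-elim (<⇒≱ x<a+0 (subst (_≤ x) (sym (+-identityʳ a)) a≤x))
  sumFrom-≤-sum (suc W) a xs u range with a ∈? xs
  ... | no a∉xs = begin
    sumFrom F a (length xs)        ≤⟨ sumFrom-mono (length xs) (n≤1+n a) ⟩
    sumFrom F (suc a) (length xs)  ≤⟨ sumFrom-≤-sum W (suc a) xs u range′ ⟩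
    sum (map F xs)                 ∎
    where open ≤-Reasoning
          range′ : All (InRange (suc a) W) xs
          range′ = All.zipWith inRange-narrow (range , All.¬Any⇒All¬ xs a∉xs)
  ... | yes a∈xs = begin
    sumFrom F a (length xs)                         ≡⟨ cong (sumFrom F a) (length-─ xs a∈xs) ⟩
    F a + sumFrom F (suc a) (length (xs ─ a∈xs))    ≤⟨ +-monoʳ-≤ (F a) (sumFrom-≤-sum W (suc a) (xs ─ a∈xs) (unique-─ u a∈xs) range′) ⟩
    F a + sum (map F (xs ─ a∈xs))                   ≡⟨ sum-map-─ F xs a∈xs ⟨
    sum (map F xs)                                  ∎
    where open ≤-Reasoning
          range′ : All (InRange (suc a) W) (xs ─ a∈xs)
          range′ = All.zipWith inRange-narrow (All.─⁺ a∈xs range , ─-≢ u a∈xs)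

-- Solutions read off from lists

-- Positions past the end of the list read the junk value 0; they never occur below.
entry : ∀ {k} → List ℕ → Fin k → ℕ
entry []       _       = 0
entry (x ∷ _)  zero    = x
entry (_ ∷ xs) (suc i) = entry xs i

tabulate-entry : ∀ {k} xs w → length xs ≡ k → tabulate (λ (i : Fin k) → entry (xs ∷ʳ w) (inject₁ i)) ≡ xs
tabulate-entry {zero}  []       w refl = refl
tabulate-entry {suc k} (x ∷ xs) w eq   = cong (x ∷_) (tabulate-entry xs w (suc-injective eq))

entry-last : ∀ {k} xs w → length xs ≡ k → entry (xs ∷ʳ w) (fromℕ k) ≡ w
entry-last {zero}  []       w refl = refl
entry-last {suc k} (x ∷ xs) w eq   = entry-last xs w (suc-injective eq)

All-entry : ∀ {P : ℕ → Set} {k ys} → All P ys → length ys ≡ k → (i : Fin k) → P (entry ys i)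
All-entry []       refl ()
All-entry (p ∷ _)  _    zero    = p
All-entry (_ ∷ ps) eq   (suc i) = All-entry ps (suc-injective eq) i

entry-injective : ∀ {k ys} → Unique ys → length ys ≡ k → {i i′ : Fin k} → entry ys i ≡ entry ys i′ → i ≡ i′
entry-injective []      refl {()}
entry-injective (_ ∷ _) _  {zero}  {zero}   _ = refl
entry-injective (h ∷ _) eq {zero}  {suc i′} e = ⊥-elim (All-entry h (suc-injective eq) i′ e)
entry-injective (h ∷ _) eq {suc i} {zero}   e = ⊥-elim (All-entry h (suc-injective eq) i (sym e))
entry-injective (_ ∷ u) eq {suc i} {suc i′} e = cong suc (entry-injective u (suc-injective eq) e)

unique-++-separated : ∀ {xs ys} b → Unique xs → Unique ys → All (_< b) xs → All (b ≤_) ys → Unique (xs ++ ys)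
unique-++-separated b ux uy below above =
  AllPairs.++⁺ ux uy (All.map (λ x<b → All.map (λ b≤y → <⇒≢ (<-≤-trans x<b b≤y)) above) below)

record DistinctSolution (A : ℕ → Bool) (k : ℕ) : Set where
  field
    summands        : List ℕ
    total           : ℕ
    length-summands : length summands ≡ k
    sum-summands    : sum summands ≡ total
    distinct        : Unique (summands ∷ʳ total)
    members         : All (T ∘ A) (summands ∷ʳ total)

module _ {n r} (c : Coloring n r) {A : ℕ → Bool}
         (A-index : ∀ {u} → T (A u) → Σ (Fin n) λ i → val i ≡ u)
         (A-rainbow : ∀ {i i′} → T (A (val i)) → T (A (val i′)) → c i ≡ c i′ → i ≡ i′) where

  rainbowSolution : ∀ {k} → DistinctSolution A k → Σ (Fin (suc k) → Fin n) λ x → IsSolution (suc k) x × Rainbow c x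
  rainbowSolution {k} S = x , solution , rainbow
    where
    open DistinctSolution S
    length-tuple : length (summands ∷ʳ total) ≡ suc k
    length-tuple = trans (length-++ summands) (trans (+-comm _ 1) (cong suc length-summands))
    z : Fin (suc k) → ℕ
    z = entry (summands ∷ʳ total)
    z∈A : ∀ i → T (A (z i))
    z∈A = All-entry members length-tuple
    x : Fin (suc k) → Fin n
    x i = proj₁ (A-index (z∈A i))
    val-x : ∀ i → val (x i) ≡ z i
    val-x i = proj₂ (A-index (z∈A i))
    x∈A : ∀ i → T (A (val (x i)))
    x∈A i = subst (T ∘ A) (sym (val-x i)) (z∈A i)
    open ≡-Reasoning
    solution : IsSolution (suc k) x
    solution = begin
      sum (tabulate (λ i → val (x (inject₁ i))))  ≡⟨ cong sum (tabulate-cong (val-x ∘ inject₁)) ⟩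
      sum (tabulate (λ i → z (inject₁ i)))        ≡⟨ cong sum (tabulate-entry summands total length-summands) ⟩
      sum summands                                ≡⟨ sum-summands ⟩
      total                                       ≡⟨ entry-last summands total length-summands ⟨
      z (fromℕ k)                                 ≡⟨ val-x (fromℕ k) ⟨
      val (x (fromℕ k))                           ∎
    rainbow : Rainbow c x
    rainbow {i} {i′} same = entry-injective distinct length-tuple (begin
      z i          ≡⟨ val-x i ⟨
      val (x i)    ≡⟨ cong val (A-rainbow (x∈A i) (x∈A i′) same) ⟩
      val (x i′)   ≡⟨ val-x i′ ⟩
      z i′         ∎)

-- First occurrences of colours

-- toℕ ∘ c on positions below n, and the junk value 0 beyond.
colourIndex : ∀ {n r} → Coloring n r → ℕ → ℕ
colourIndex {zero}  c _       = 0
colourIndex {suc n} c zero    = toℕ (c zero)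
colourIndex {suc n} c (suc i) = colourIndex (c ∘ suc) i

colourIndex-toℕ : ∀ {n r} (c : Coloring n r) i → colourIndex c (toℕ i) ≡ toℕ (c i)
colourIndex-toℕ {suc n} c zero    = refl
colourIndex-toℕ {suc n} c (suc i) = colourIndex-toℕ (c ∘ suc) i

module FirstOccurrences {n r} (c : Coloring n r) where

  colour : ℕ → ℕ
  colour = colourIndex c

  usedBefore : ℕ → ℕ → Bool
  usedBefore q zero    = false
  usedBefore q (suc k) = usedBefore q k ∨ (colour k ≡ᵇ q)

  isNew : ℕ → Bool
  isNew i = not (usedBefore (colour i) i)

  -- Indexed by values u ∈ [1, n], unlike isNew, which is indexed by positions u - 1.
  isFirst : ℕ → Bool
  isFirst zero    = false
  isFirst (suc i) = (i <ᵇ n) ∧ isNew i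

  usedBefore-intro : ∀ {i k} → i < k → T (usedBefore (colour i) k)
  usedBefore-intro {i} {suc k} i<1+k with m≤n⇒m<n∨m≡n (s≤s⁻¹ i<1+k)
  ... | inj₁ i<k  = from T-∨ (inj₁ (usedBefore-intro i<k))
  ... | inj₂ refl = from T-∨ (inj₂ (≡⇒≡ᵇ (colour i) (colour i) refl))

  isNew-distinct : ∀ {i i′} → i < i′ → T (isNew i′) → colour i ≢ colour i′
  isNew-distinct {i} {i′} i<i′ new same = contradiction used new
    where
    used : T (usedBefore (colour i′) i′)
    used = subst (λ q → T (usedBefore q i′)) same (usedBefore-intro i<i′)
    contradiction : ∀ {b} → T b → ¬ T (not b)
    contradiction {true} _ ()

  isNew-injective : ∀ {i i′} → T (isNew i) → T (isNew i′) → colour i ≡ colour i′ → i ≡ i′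
  isNew-injective {i} {i′} new new′ same with <-cmp i i′
  ... | tri< i<i′ _ _ = ⊥-elim (isNew-distinct i<i′ new′ same)
  ... | tri≈ _ i≡i′ _ = i≡i′
  ... | tri> _ _ i′<i = ⊥-elim (isNew-distinct i′<i new (sym same))

  isFirst-index : ∀ {u} → T (isFirst u) → Σ (Fin n) λ i → val i ≡ u
  isFirst-index {suc i} first = fromℕ< i<n , cong suc (toℕ-fromℕ< i<n)
    where i<n = <ᵇ⇒< i n (proj₁ (to T-∧ first))

  isFirst-rainbow : ∀ {i i′} → T (isFirst (val i)) → T (isFirst (val i′)) → c i ≡ c i′ → i ≡ i′
  isFirst-rainbow {i} {i′} first first′ same =
    toℕ-injective (isNew-injective (proj₂ (to T-∧ first)) (proj₂ (to T-∧ first′)) (begin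
      colour (toℕ i)   ≡⟨ colourIndex-toℕ c i ⟩
      toℕ (c i)        ≡⟨ cong toℕ same ⟩
      toℕ (c i′)       ≡⟨ colourIndex-toℕ c i′ ⟨
      colour (toℕ i′)  ∎))
    where open ≡-Reasoning

  isFirst-one : 0 < n → T (isFirst 1)
  isFirst-one 0<n = from T-∧ (<⇒<ᵇ 0<n , tt)

  coloursUsedBefore : ℕ → ℕ
  coloursUsedBefore k = count (λ q → usedBefore q k) 0 r

  coloursUsedBefore-≤ : ∀ k → coloursUsedBefore k ≤ count isNew 0 k
  coloursUsedBefore-≤ zero    = ≤-reflexive (count-none _ 0 r (λ _ _ ()))
  coloursUsedBefore-≤ (suc k) with T? (usedBefore (colour k) k)
  ... | yes used = begin
    coloursUsedBefore (suc k)      ≤⟨ count-mono 0 r (λ q _ → old q ∘ to T-∨) ⟩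
    coloursUsedBefore k            ≤⟨ coloursUsedBefore-≤ k ⟩
    count isNew 0 k                ≤⟨ m≤m+n _ _ ⟩
    count isNew 0 (suc k)          ∎
    where
    open ≤-Reasoning
    old : ∀ q → T (usedBefore q k) ⊎ T (colour k ≡ᵇ q) → T (usedBefore q k)
    old q (inj₁ u) = u
    old q (inj₂ e) = subst (λ q → T (usedBefore q k)) (≡ᵇ⇒≡ (colour k) q e) used
  ... | no unused = begin
    coloursUsedBefore (suc k)                                    ≤⟨ count-∨ _ _ 0 r ⟩
    coloursUsedBefore k + count (colour k ≡ᵇ_) 0 r               ≤⟨ +-mono-≤ (coloursUsedBefore-≤ k) (count-≡ᵇ≤1 (colour k) 0 r) ⟩
    count isNew 0 k + 1                                          ≡⟨ cong (count isNew 0 k +_) (bit-not unused) ⟨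
    count isNew 0 (suc k)                                        ∎
    where open ≤-Reasoning

  exact⇒≤count-isFirst : Exact c → r ≤ count isFirst 1 n
  exact⇒≤count-isFirst exact = begin
    r                        ≡⟨ count-all _ 0 r every-colour-used ⟨
    coloursUsedBefore n      ≤⟨ coloursUsedBefore-≤ n ⟩
    count isNew 0 n          ≤⟨ count-mono 0 n (λ i (_ , i<n) new → from T-∧ (<⇒<ᵇ i<n , new)) ⟩
    count (isFirst ∘ suc) 0 n ≡⟨ count-suc isFirst 0 n ⟨
    count isFirst 1 n        ∎
    where
    open ≤-Reasoning
    every-colour-used : ∀ q → InRange 0 r q → T (usedBefore q n)
    every-colour-used q (_ , q<r) = subst (λ q → T (usedBefore q n)) colour-i≡q (usedBefore-intro (toℕ<n i))
      where
      i = proj₁ (exact (fromℕ< q<r))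
      colour-i≡q : colour (toℕ i) ≡ q
      colour-i≡q = trans (colourIndex-toℕ c i) (trans (cong toℕ (proj₂ (exact (fromℕ< q<r)) refl)) (toℕ-fromℕ< q<r))

-- Sets with few gaps contain solutions

count-intermediate-from-1 : ∀ A n k → T (A 1) → suc k ≤ count A 1 n → Σ ℕ λ l → suc l ≤ n × count A 2 l ≡ k
count-intermediate-from-1 A n k A1 enough with count-intermediate A 1 n enough
... | zero  , _   , ()
... | suc l , l<n , eq = l , l<n , suc-injective (begin
  suc (count A 2 l)          ≡⟨ cong (_+ count A 2 l) (bit-true A1) ⟨
  count A 1 1 + count A 2 l  ≡⟨ count-++ A 1 1 l ⟨
  count A 1 (suc l)          ≡⟨ eq ⟩
  suc k                      ∎)
  where open ≡-Reasoning

-- Pigeonhole: at most g points of [a, a + len) miss A, and at most g are sent outside A by v ↦ v + p.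
shifted-pair : ∀ A a p len → let g = count (not ∘ A) a (p + len) in g + g < len →
  Σ ℕ λ v → InRange a len v × T (A v) × T (A (v + p))
shifted-pair A a p len 2g<len =
  let v , v∈ , hit = count-witness _ a len pairs-exist in v , v∈ , to T-∧ hit
  where
  open ≤-Reasoning
  g = count (not ∘ A) a (p + len)
  pairs = count (λ v → A v ∧ A (v + p)) a len
  gaps-front : count (not ∘ A) a len ≤ g
  gaps-front = begin
    count (not ∘ A) a len                                   ≤⟨ m≤m+n _ _ ⟩
    count (not ∘ A) a len + count (not ∘ A) (a + len) p     ≡⟨ count-++ (not ∘ A) a len p ⟨
    count (not ∘ A) a (len + p)                             ≡⟨ cong (count (not ∘ A) a) (+-comm len p) ⟩
    g                                                       ∎
  gaps-back : count (not ∘ A) (a + p) len ≤ g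
  gaps-back = begin
    count (not ∘ A) (a + p) len                             ≤⟨ m≤n+m _ _ ⟩
    count (not ∘ A) a p + count (not ∘ A) (a + p) len       ≡⟨ count-++ (not ∘ A) a p len ⟨
    g                                                       ∎
  len≤ : len ≤ pairs + (g + g)
  len≤ = begin
    len                                                              ≤⟨ count-window A a p len ⟩
    pairs + count (not ∘ A) a len + count (not ∘ A) (a + p) len      ≤⟨ +-mono-≤ (+-monoʳ-≤ pairs gaps-front) gaps-back ⟩
    pairs + g + g                                                    ≡⟨ +-assoc pairs g g ⟩
    pairs + (g + g)                                                  ∎
  pairs-exist : 0 < pairs
  pairs-exist = +-cancelʳ-< (g + g) 0 pairs (<-≤-trans 2g<len len≤)

appendPair : ∀ {A k} pre v b → length pre ≡ k → Unique pre → All (_< b) pre → All (T ∘ A) pre →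
  0 < sum pre → b ≤ v → T (A v) → T (A (v + sum pre)) → DistinctSolution A (suc k)
appendPair {A} pre v b len unique below members p>0 b≤v Av Avp = record
  { summands        = pre ∷ʳ v
  ; total           = v + p
  ; length-summands = trans (length-++ pre) (trans (+-comm _ 1) (cong suc len))
  ; sum-summands    = trans (sum-++ pre (v ∷ [])) (trans (cong (p +_) (+-identityʳ v)) (+-comm p v))
  ; distinct        = subst Unique (sym reassoc)
      (unique-++-separated b unique ((<⇒≢ (m<m+n v p>0) ∷ []) ∷ [] ∷ []) below (b≤v ∷ ≤-trans b≤v (m≤m+n v p) ∷ []))
  ; members         = subst (All (T ∘ A)) (sym reassoc) (All.++⁺ members (Av ∷ Avp ∷ []))
  }
  where
  p = sum pre
  reassoc : (pre ∷ʳ v) ∷ʳ (v + p) ≡ pre ++ v ∷ v + p ∷ []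
  reassoc = ++-assoc pre (v ∷ []) (v + p ∷ [])

2+j≤t : ∀ j t → 2 * t ≡ (4 + j) * (3 + j) → 2 + j ≤ t
2+j≤t j t 2t≡ = *-cancelˡ-≤ 2 (begin
  2 * (2 + j)                         ≤⟨ m≤m+n _ (j * j + 5 * j + 8) ⟩
  2 * (2 + j) + (j * j + 5 * j + 8)   ≡⟨ expand j ⟩
  (4 + j) * (3 + j)                   ≡⟨ 2t≡ ⟨
  2 * t                               ∎)
  where
  open ≤-Reasoning
  expand : ∀ j → 2 * (2 + j) + (j * j + 5 * j + 8) ≡ (4 + j) * (3 + j)
  expand = solve-∀

-- [1, 2 + j + c] holds the 2 + j smallest members, of sum 1 + S, and c gaps; the remaining
-- rest numbers up to n hold d gaps.
window-fits : ∀ j t c d S rest → 2 * t ≡ (4 + j) * (3 + j) →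
  (2 + j) * (c + d) + t ≤ 2 + j + c + rest →
  2 * S + (1 + j) * (2 + j) ≤ 2 * (1 + j) * (3 + j + c) →
  suc S + (d + d) < rest
window-fits j t c d S rest 2t≡ gaps prefix = *-cancelˡ-≤ 2 (+-cancelʳ-≤ X _ _ (begin
  2 * suc (suc S + (d + d)) + X
    ≡⟨ e₁ j c d S ⟩
  (2 * S + (1 + j) * (2 + j)) + (2 * (2 + j + c) + 4 * d + 4)
    ≤⟨ +-monoˡ-≤ _ prefix ⟩
  2 * (1 + j) * (3 + j + c) + (2 * (2 + j + c) + 4 * d + 4)
    ≡⟨ e₂ j c d ⟩
  (4 + j) * (3 + j) + 2 * (2 + j) * c + 4 * d + (1 + j) * (2 + j)
    ≡⟨ cong (λ q → q + 2 * (2 + j) * c + 4 * d + (1 + j) * (2 + j)) 2t≡ ⟨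
  2 * t + 2 * (2 + j) * c + 4 * d + (1 + j) * (2 + j)
    ≤⟨ +-monoˡ-≤ ((1 + j) * (2 + j)) (+-monoʳ-≤ (2 * t + 2 * (2 + j) * c) (*-monoˡ-≤ d (*-monoʳ-≤ 2 (m≤m+n 2 j)))) ⟩
  2 * t + 2 * (2 + j) * c + 2 * (2 + j) * d + (1 + j) * (2 + j)
    ≡⟨ e₃ j t c d ⟩
  2 * ((2 + j) * (c + d) + t) + (1 + j) * (2 + j)
    ≤⟨ +-monoˡ-≤ _ (*-monoʳ-≤ 2 gaps) ⟩
  2 * (2 + j + c + rest) + (1 + j) * (2 + j)
    ≡⟨ e₄ j c rest ⟩
  2 * rest + X
    ∎))
  where
  open ≤-Reasoning
  X = (1 + j) * (2 + j) + 2 * (2 + j + c)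
  e₁ : ∀ j c d S → 2 * suc (suc S + (d + d)) + ((1 + j) * (2 + j) + 2 * (2 + j + c))
                 ≡ (2 * S + (1 + j) * (2 + j)) + (2 * (2 + j + c) + 4 * d + 4)
  e₁ = solve-∀
  e₂ : ∀ j c d → 2 * (1 + j) * (3 + j + c) + (2 * (2 + j + c) + 4 * d + 4)
               ≡ (4 + j) * (3 + j) + 2 * (2 + j) * c + 4 * d + (1 + j) * (2 + j)
  e₂ = solve-∀
  e₃ : ∀ j t c d → 2 * t + 2 * (2 + j) * c + 2 * (2 + j) * d + (1 + j) * (2 + j)
                 ≡ 2 * ((2 + j) * (c + d) + t) + (1 + j) * (2 + j)
  e₃ = solve-∀
  e₄ : ∀ j c rest → 2 * (2 + j + c + rest) + (1 + j) * (2 + j) ≡ 2 * rest + ((1 + j) * (2 + j) + 2 * (2 + j + c))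
  e₄ = solve-∀

prefix-leaves-window : ∀ j n t (A : ℕ → Bool) → 2 * t ≡ (4 + j) * (3 + j) → T (A 1) →
  (2 + j) * count (not ∘ A) 1 n + t ≤ n →
  Σ ℕ λ l → let rest = n ∸ suc l ; d = count (not ∘ A) (2 + l) rest in
    count A 2 l ≡ 1 + j × suc (sum (elements A 2 l)) + (d + d) < rest
prefix-leaves-window j n t A 2t≡ A1 gaps =
  l , members-below , window-fits j t c d S rest 2t≡ (subst₂ (λ g n → (2 + j) * g + t ≤ n) gapCount≡ (sym n≡) gaps) prefix-sum
  where
  open ≡-Reasoning
  gapCount = count (not ∘ A) 1 n
  t≤members : t ≤ count A 1 n
  t≤members = +-cancelˡ-≤ gapCount _ _ (≤-trans (+-monoˡ-≤ t (m≤m+n gapCount _)) (≤-trans gaps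
    (≤-reflexive (trans (sym (count-complement A 1 n)) (+-comm _ gapCount)))))
  segment = count-intermediate-from-1 A n (1 + j) A1 (≤-trans (2+j≤t j t 2t≡) t≤members)
  l = proj₁ segment
  l<n : suc l ≤ n
  l<n = proj₁ (proj₂ segment)
  members-below : count A 2 l ≡ 1 + j
  members-below = proj₂ (proj₂ segment)
  S = sum (elements A 2 l)
  c = count (not ∘ A) 2 l
  rest = n ∸ suc l
  d = count (not ∘ A) (2 + l) rest
  l≡ : 1 + j + c ≡ l
  l≡ = trans (cong (_+ c) (sym members-below)) (count-complement A 2 l)
  n≡ : 2 + j + c + rest ≡ n
  n≡ = trans (cong (λ l → suc l + rest) l≡) (m+[n∸m]≡n l<n)
  gapCount≡ : gapCount ≡ c + d
  gapCount≡ = begin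
    count (not ∘ A) 1 n                                ≡⟨ cong (count (not ∘ A) 1) (m+[n∸m]≡n l<n) ⟨
    count (not ∘ A) 1 (1 + (l + rest))                 ≡⟨ count-++ (not ∘ A) 1 1 (l + rest) ⟩
    count (not ∘ A) 1 1 + count (not ∘ A) 2 (l + rest) ≡⟨ cong (_+ count (not ∘ A) 2 (l + rest)) (bit-not-true A1) ⟩
    count (not ∘ A) 2 (l + rest)                       ≡⟨ count-++ (not ∘ A) 2 l rest ⟩
    c + d                                              ∎
  prefix-sum : 2 * S + (1 + j) * (2 + j) ≤ 2 * (1 + j) * (3 + j + c)
  prefix-sum = subst₂ (λ k e → 2 * S + k * suc k ≤ 2 * k * e) members-below (cong (2 +_) (sym l≡)) (sum-elements A 2 l)

denseSet-solution : ∀ j n t (A : ℕ → Bool) → 2 * t ≡ (4 + j) * (3 + j) → T (A 1) →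
  (2 + j) * count (not ∘ A) 1 n + t ≤ n → DistinctSolution A (3 + j)
denseSet-solution j n t A 2t≡ A1 gaps =
  appendPair prefix v (2 + l) prefix-length prefix-unique prefix-below prefix-members (s≤s z≤n) 2+l≤v Av AvP
  where
  window = prefix-leaves-window j n t A 2t≡ A1 gaps
  l = proj₁ window
  members-below : count A 2 l ≡ 1 + j
  members-below = proj₁ (proj₂ window)
  prefix = 1 ∷ elements A 2 l
  prefix-length : length prefix ≡ 2 + j
  prefix-length = cong suc (trans (length-elements A 2 l) members-below)
  prefix-unique : Unique prefix
  prefix-unique = All.map (λ ((2≤i , _) , _) → <⇒≢ 2≤i) (elements-all A 2 l) ∷ elements-unique A 2 l
  prefix-below : All (_< 2 + l) prefix
  prefix-below = s≤s (s≤s z≤n) ∷ All.map (proj₂ ∘ proj₁) (elements-all A 2 l)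
  prefix-members : All (T ∘ A) prefix
  prefix-members = A1 ∷ All.map proj₂ (elements-all A 2 l)
  P = suc (sum (elements A 2 l))
  rest = n ∸ suc l
  len = rest ∸ P
  d = count (not ∘ A) (2 + l) rest
  fits : P + (d + d) < rest
  fits = proj₂ (proj₂ window)
  rest≡ : P + len ≡ rest
  rest≡ = m+[n∸m]≡n (≤-trans (m≤m+n P _) (<⇒≤ fits))
  pair = shifted-pair A (2 + l) P len
    (+-cancelˡ-< P _ _ (subst (λ r → P + (count (not ∘ A) (2 + l) r + count (not ∘ A) (2 + l) r) < r) (sym rest≡) fits))
  v = proj₁ pair
  2+l≤v : 2 + l ≤ v
  2+l≤v = proj₁ (proj₁ (proj₂ pair))
  Av : T (A v)
  Av = proj₁ (proj₂ (proj₂ pair))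
  AvP : T (A (v + P))
  AvP = proj₂ (proj₂ (proj₂ pair))

-- The bounds on RS_m(n)

few-gaps : ∀ j n s t b → (1 + j) * n + t ≤ (2 + j) * s → s + b ≤ n → (2 + j) * b + t ≤ n
few-gaps j n s t b lower s+b≤n = +-cancelˡ-≤ ((1 + j) * n) _ _ (begin
  (1 + j) * n + ((2 + j) * b + t)  ≡⟨ regroup j n b t ⟩
  ((1 + j) * n + t) + (2 + j) * b  ≤⟨ +-monoˡ-≤ _ lower ⟩
  (2 + j) * s + (2 + j) * b        ≡⟨ *-distribˡ-+ (2 + j) s b ⟨
  (2 + j) * (s + b)                ≤⟨ *-monoʳ-≤ (2 + j) s+b≤n ⟩
  (2 + j) * n                      ≡⟨ +-comm n _ ⟩
  (1 + j) * n + n                  ∎)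
  where
  open ≤-Reasoning
  regroup : ∀ j n b t → (1 + j) * n + ((2 + j) * b + t) ≡ ((1 + j) * n + t) + (2 + j) * b
  regroup = solve-∀

rainbowProperty-above : ∀ j n s t → 2 * t ≡ (4 + j) * (3 + j) → t ≤ n →
  (1 + j) * n + t ≤ (2 + j) * s → HasRainbowProperty (4 + j) n s
rainbowProperty-above j n s t 2t≡ t≤n lower c exact =
  rainbowSolution c isFirst-index isFirst-rainbow
    (denseSet-solution j n t isFirst 2t≡ (isFirst-one 0<n) (few-gaps j n s t _ lower s+gaps≤n))
  where
  open FirstOccurrences c
  0<n : 0 < n
  0<n = <-≤-trans (s≤s z≤n) (≤-trans (2+j≤t j t 2t≡) t≤n)
  s+gaps≤n : s + count (not ∘ isFirst) 1 n ≤ n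
  s+gaps≤n = ≤-trans (+-monoˡ-≤ _ (exact⇒≤count-isFirst exact)) (≤-reflexive (count-complement isFirst 1 n))

staircase : ∀ {n} (o r : ℕ) → Coloring n (suc r)
staircase o r i = fromℕ< (s≤s (m⊓n≤m r (toℕ i ∸ o)))

toℕ-staircase : ∀ {n} o r (i : Fin n) → toℕ (staircase o r i) ≡ r ⊓ (toℕ i ∸ o)
toℕ-staircase o r i = toℕ-fromℕ< _

staircase-exact : ∀ {n} o r → r + o < n → Exact (staircase {n} o r)
staircase-exact {n} o r r+o<n q = i , λ { refl → toℕ-injective (begin
  toℕ (staircase o r i)        ≡⟨ toℕ-staircase o r i ⟩
  r ⊓ (toℕ i ∸ o)              ≡⟨ cong (λ p → r ⊓ (p ∸ o)) (toℕ-fromℕ< q+o<n) ⟩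
  r ⊓ (toℕ q + o ∸ o)          ≡⟨ cong (r ⊓_) (m+n∸n≡m (toℕ q) o) ⟩
  r ⊓ toℕ q                    ≡⟨ m≥n⇒m⊓n≡n (s≤s⁻¹ (toℕ<n q)) ⟩
  toℕ q                        ∎) }
  where
  open ≡-Reasoning
  q+o<n : toℕ q + o < n
  q+o<n = <-≤-trans (+-monoˡ-< o (toℕ<n q)) r+o<n
  i = fromℕ< q+o<n

-- The least value p + 1 with p ∸ o = y.
stepValue : ℕ → ℕ → ℕ
stepValue o zero    = 1
stepValue o (suc y) = suc y + suc o

stepValue-mono : ∀ o → stepValue o Preserves _≤_ ⟶ _≤_
stepValue-mono o {zero}  {zero}  _     = ≤-refl
stepValue-mono o {zero}  {suc _} _     = s≤s z≤n
stepValue-mono o {suc _} {suc _} y≤y′ = +-monoˡ-≤ (suc o) y≤y′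

stepValue-suc : ∀ o y → stepValue (suc o) y ≤ suc (stepValue o y)
stepValue-suc o zero    = s≤s z≤n
stepValue-suc o (suc y) = ≤-reflexive (+-suc (suc y) (suc o))

stepValue-≤ : ∀ o p → stepValue o (p ∸ o) ≤ suc p
stepValue-≤ zero    zero    = ≤-refl
stepValue-≤ zero    (suc p) = ≤-reflexive (+-comm (suc p) 1)
stepValue-≤ (suc o) zero    = ≤-refl
stepValue-≤ (suc o) (suc p) = ≤-trans (stepValue-suc o (p ∸ o)) (s≤s (stepValue-≤ o p))

sumFrom-stepValue : ∀ o a L → 2 * sumFrom (stepValue o) (suc a) L ≡ L * (2 * (a + suc o) + L + 1)
sumFrom-stepValue o a zero    = refl
sumFrom-stepValue o a (suc L) = begin
  2 * (suc a + suc o + sumFrom (stepValue o) (suc (suc a)) L)     ≡⟨ *-distribˡ-+ 2 (suc a + suc o) _ ⟩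
  2 * (suc a + suc o) + 2 * sumFrom (stepValue o) (suc (suc a)) L ≡⟨ cong (2 * (suc a + suc o) +_) (sumFrom-stepValue o (suc a) L) ⟩
  2 * (suc a + suc o) + L * (2 * (suc a + suc o) + L + 1)         ≡⟨ expand a (suc o) L ⟩
  suc L * (2 * (a + suc o) + suc L + 1)                           ∎
  where
  open ≡-Reasoning
  expand : ∀ a k L → 2 * (suc a + k) + L * (2 * (suc a + k) + L + 1) ≡ suc L * (2 * (a + k) + suc L + 1)
  expand = solve-∀

sum-tabulate-mono : ∀ {L} {f g : Fin L → ℕ} → (∀ i → f i ≤ g i) → sum (tabulate f) ≤ sum (tabulate g)
sum-tabulate-mono {zero}  _   = z≤n
sum-tabulate-mono {suc L} f≤g = +-mono-≤ (f≤g zero) (sum-tabulate-mono (f≤g ∘ suc))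

-- The summands of a rainbow solution lie on distinct steps of the staircase.
staircase-sum : ∀ {n L} o r (x : Fin (suc L) → Fin n) → Rainbow (staircase o r) x →
  sumFrom (stepValue o) 0 L ≤ sum (tabulate (λ i → val (x (inject₁ i))))
staircase-sum {n} {L} o r x rainbow = begin
  sumFrom (stepValue o) 0 L                   ≡⟨ cong (sumFrom (stepValue o) 0) (length-tabulate step) ⟨
  sumFrom (stepValue o) 0 (length steps)      ≤⟨ sumFrom-≤-sum (stepValue-mono o) n 0 steps (tabulate⁺ step-injective) steps-range ⟩
  sum (map (stepValue o) steps)               ≡⟨ cong sum (map-tabulate step (stepValue o)) ⟩
  sum (tabulate (stepValue o ∘ step))         ≤⟨ sum-tabulate-mono (λ i → stepValue-≤ o (toℕ (x (inject₁ i)))) ⟩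
  sum (tabulate (λ i → val (x (inject₁ i))))  ∎
  where
  open ≤-Reasoning
  step : Fin L → ℕ
  step i = toℕ (x (inject₁ i)) ∸ o
  steps = tabulate step
  steps-range : All (InRange 0 n) steps
  steps-range = All.tabulate⁺ (λ i → z≤n , ≤-<-trans (m∸n≤m _ o) (toℕ<n (x (inject₁ i))))
  step-injective : ∀ {i i′} → step i ≡ step i′ → i ≡ i′
  step-injective {i} {i′} same = inject₁-injective (rainbow (toℕ-injective (begin-equality
    toℕ (staircase o r (x (inject₁ i)))   ≡⟨ toℕ-staircase o r _ ⟩
    r ⊓ step i                            ≡⟨ cong (r ⊓_) same ⟩
    r ⊓ step i′                           ≡⟨ toℕ-staircase o r _ ⟨
    toℕ (staircase o r (x (inject₁ i′)))  ∎)))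

staircase-arithmetic : ∀ j n s t k → 2 * t ≡ (4 + j) * (3 + j) →
  (2 + j) * s ≤ (1 + j) * n + t + (1 + j) → k + s ≡ 2 + n →
  2 * n ≤ (2 + j) * (2 * k + (2 + j) + 1)
staircase-arithmetic j n s t k 2t≡ upper k+s≡ = +-cancelʳ-≤ (2 * ((2 + j) * s)) _ _ (begin
  2 * n + 2 * ((2 + j) * s)                         ≤⟨ +-monoʳ-≤ (2 * n) (*-monoʳ-≤ 2 upper) ⟩
  2 * n + 2 * ((1 + j) * n + t + (1 + j))           ≡⟨ e₁ j n t ⟩
  2 * n + 2 * ((1 + j) * n) + 2 * t + 2 * (1 + j)   ≡⟨ cong (λ q → 2 * n + 2 * ((1 + j) * n) + q + 2 * (1 + j)) 2t≡ ⟩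
  2 * n + 2 * ((1 + j) * n) + (4 + j) * (3 + j) + 2 * (1 + j)
                                                    ≡⟨ e₂ j n ⟩
  2 * (2 + j) * (2 + n) + (2 + j) * (3 + j)         ≡⟨ cong (λ q → 2 * (2 + j) * q + (2 + j) * (3 + j)) k+s≡ ⟨
  2 * (2 + j) * (k + s) + (2 + j) * (3 + j)         ≡⟨ e₃ j k s ⟩
  (2 + j) * (2 * k + (2 + j) + 1) + 2 * ((2 + j) * s) ∎)
  where
  open ≤-Reasoning
  e₁ : ∀ j n t → 2 * n + 2 * ((1 + j) * n + t + (1 + j)) ≡ 2 * n + 2 * ((1 + j) * n) + 2 * t + 2 * (1 + j)
  e₁ = solve-∀
  e₂ : ∀ j n → 2 * n + 2 * ((1 + j) * n) + (4 + j) * (3 + j) + 2 * (1 + j) ≡ 2 * (2 + j) * (2 + n) + (2 + j) * (3 + j)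
  e₂ = solve-∀
  e₃ : ∀ j k s → 2 * (2 + j) * (k + s) + (2 + j) * (3 + j) ≡ (2 + j) * (2 * k + (2 + j) + 1) + 2 * ((2 + j) * s)
  e₃ = solve-∀

¬rainbowProperty-below : ∀ j n s t r → 2 * t ≡ (4 + j) * (3 + j) → s ≤ n →
  (2 + j) * s ≤ (1 + j) * n + t + (1 + j) → suc r < s → ¬ HasRainbowProperty (4 + j) n (suc r)
¬rainbowProperty-below j n s t r 2t≡ s≤n upper r<s property =
  let x , solution , rainbow = property (staircase o r) (staircase-exact o r fits) in
  <⇒≱ (<-≤-trans n<sum (staircase-sum o r x rainbow)) (≤-trans (≤-reflexive solution) (toℕ<n _))
  where
  o = suc (n ∸ s)
  fits : r + o < n
  fits = begin-strict
    r + suc (n ∸ s)      ≡⟨ +-suc r (n ∸ s) ⟩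
    suc r + (n ∸ s)      <⟨ +-monoˡ-< (n ∸ s) r<s ⟩
    s + (n ∸ s)          ≡⟨ m+[n∸m]≡n s≤n ⟩
    n                    ∎
    where open ≤-Reasoning
  n<sum : n < sumFrom (stepValue o) 0 (3 + j)
  n<sum = s≤s (*-cancelˡ-≤ 2 (≤-trans
    (staircase-arithmetic j n s t (suc o) 2t≡ upper (cong (2 +_) (m∸n+n≡m s≤n)))
    (≤-reflexive (sym (sumFrom-stepValue o 0 (2 + j))))))

ceilDiv-lower : ∀ a d → a ≤ suc d * ceilDiv a (suc d)
ceilDiv-lower a d = +-cancelʳ-≤ d _ _ (begin
  a + d                      ≡⟨ m≡m%n+[m/n]*n (a + d) (suc d) ⟩
  (a + d) % suc d + q * suc d ≤⟨ +-monoˡ-≤ _ (s≤s⁻¹ (m%n<n (a + d) (suc d))) ⟩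
  d + q * suc d              ≡⟨ +-comm d _ ⟩
  q * suc d + d              ≡⟨ cong (_+ d) (*-comm q (suc d)) ⟩
  suc d * q + d              ∎)
  where
  open ≤-Reasoning
  q = (a + d) / suc d

ceilDiv-upper : ∀ a d → suc d * ceilDiv a (suc d) ≤ a + d
ceilDiv-upper a d = ≤-trans (≤-reflexive (*-comm (suc d) _)) (m/n*n≤m (a + d) (suc d))

ceilDiv-positive : ∀ a d → 1 ≤ a → 1 ≤ ceilDiv a (suc d)
ceilDiv-positive a d 1≤a = m≥n⇒m/n>0 (+-monoˡ-≤ d 1≤a)

ceiling-≤ : ∀ j n s t → t ≤ n → (2 + j) * s ≤ (1 + j) * n + t + (1 + j) → s ≤ n
ceiling-≤ j n s t t≤n upper = s≤s⁻¹ (*-cancelˡ-< (2 + j) s (suc n) (begin-strict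
  (2 + j) * s                  ≤⟨ upper ⟩
  (1 + j) * n + t + (1 + j)    ≤⟨ +-monoˡ-≤ (1 + j) (+-monoʳ-≤ ((1 + j) * n) t≤n) ⟩
  (1 + j) * n + n + (1 + j)    <⟨ ≤-reflexive (expand j n) ⟩
  (2 + j) * suc n              ∎))
  where
  open ≤-Reasoning
  expand : ∀ j n → suc ((1 + j) * n + n + (1 + j)) ≡ (2 + j) * suc n
  expand = solve-∀

2∣[1+n]*n : ∀ k → 2 ∣ suc k * k
2∣[1+n]*n zero    = divides 0 refl
2∣[1+n]*n (suc k) = subst (2 ∣_) (expand k) (∣m∣n⇒∣m+n (2∣[1+n]*n k) (m∣m*n (suc k)))
  where
  expand : ∀ k → suc k * k + 2 * suc k ≡ suc (suc k) * suc k
  expand = solve-∀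

theorem5 : (m n : ℕ) → 4 ≤ m → m * (m ∸ 1) / 2 ≤ n →
    IsRS m n (ceilDiv ((m ∸ 3) * n + m * (m ∸ 1) / 2) (m ∸ 2))
theorem5 (suc (suc (suc (suc j)))) n (s≤s (s≤s (s≤s (s≤s z≤n)))) t≤n =
  (1≤s , rainbowProperty-above j n s t 2t≡ t≤n lower) , minimal
  where
  t = (4 + j) * (3 + j) / 2
  2t≡ : 2 * t ≡ (4 + j) * (3 + j)
  2t≡ = m*[n/m]≡n (2∣[1+n]*n (3 + j))
  1≤t : 1 ≤ t
  1≤t = ≤-trans (s≤s z≤n) (2+j≤t j t 2t≡)
  s = ceilDiv ((1 + j) * n + t) (2 + j)
  1≤s : 1 ≤ s
  1≤s = ceilDiv-positive ((1 + j) * n + t) (1 + j) (≤-trans 1≤t (m≤n+m t _))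
  lower : (1 + j) * n + t ≤ (2 + j) * s
  lower = ceilDiv-lower _ (1 + j)
  upper : (2 + j) * s ≤ (1 + j) * n + t + (1 + j)
  upper = ceilDiv-upper _ (1 + j)
  minimal : ∀ r → 1 ≤ r → HasRainbowProperty (4 + j) n r → s ≤ r
  minimal (suc r) _ property =
    ≮⇒≥ (λ r<s → ¬rainbowProperty-below j n s t r 2t≡ (ceiling-≤ j n s t t≤n upper) upper r<s property)
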